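{- Let $B$ be a unital B0-system, and let $T_j$ be the iterated operations defined below. Then, for $Y\in B_{n+j}$ and $X\in B_{m+1}$ with $ft^j(Y)=ft^{m+1-n}(X)$ and $m>n$ (so that both sides are defined), one has $$T_j(Y,ft(X))=ft(T_j(Y,X)).$$
   Context: A non-unital pre-B-system consists of sets $B_n$, $\widetilde{B}_{n+1}$ ($n\in\mathbf{N}$), maps $ft:B_{n+1}\to B_n$, $\partial:\widetilde{B}_{n+1}\to B_{n+1}$, an element $pt\in B_0$, and for $m\ge n$ operations $T$, $\widetilde{T}$, $S$, $\widetilde{S}$; in particular $T$ sends $(Y,X)$ with $Y\in B_{n+1}$, $X\in B_{m+1}$, $ft(Y)=ft^{m+1-n}(X)$ to $T(Y,X)\in B_{m+2}$. A unital pre-B-system additionally has operations $\delta:B_{n+1}\to\widetilde{B}_{n+2}$. A (unital) B0-system is such a system satisfying, among other conditions, that for $Y\in B_{n+1}$, $X\in B_{m+1}$ with $ft(Y)=ft^{m+1-n}(X)$, $m\ge n\ge 0$: $ft(T(Y,X))=T(Y,ft(X))$ if $m>n$ and $ft(T(Y,X))=Y$ if $m=n$. For $Y\in B_{n+j}$ and $X\in B_{m+1}$ with $ft^j(Y)=ft^{m+1-n}(X)$, the maps $T_j(Y,X)\in B_{m+1+j}$ are defined inductively by $T_0(Y,X)=X$ and $T_j(Y,X)=T(Y,T_{j-1}(ft(Y),X))$ for $j>0$. -}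

module Defs where

open import Data.Nat using (ℕ; zero; suc; _+_)
open import Relation.Binary.PropositionalEquality using (_≡_; refl; sym; trans; cong)

-- Conventions:
--  * B n      is the set B_n.
--  * Bt n     is the set B̃_{n+1}  (the tilde sets only exist in degrees ≥ 1).
--  * For m ≥ n we write m = k + n; then ft^{m+1-n} = ftⁱ (suc k).
--  * B_{m+2} is written B (suc (k + suc n)) (numerically equal to m+2),
--    chosen so that the iterated T_j is definable without transport.
--  * The equality hypotheses of the operations are irrelevant arguments
--    (they are propositions about elements of sets).

iter-ft : (B : ℕ → Set) → (∀ {n} → B (suc n) → B n) → ∀ i {n} → B (i + n) → B n
iter-ft B ft zero    x = x
iter-ft B ft (suc i) x = iter-ft B ft i (ft x)

record UnitalPreBSystem : Set₁ where
  field
    B   : ℕ → Set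
    Bt  : ℕ → Set
    ft  : ∀ {n} → B (suc n) → B n
    ∂   : ∀ {n} → Bt n → B (suc n)
    pt  : B 0

  ftⁱ : ∀ i {n} → B (i + n) → B n
  ftⁱ = iter-ft B ft

  field
    T  : ∀ {n} k (Y : B (suc n)) (X : B (suc (k + n))) →
         .(ft Y ≡ ftⁱ (suc k) X) → B (suc (k + suc n))
    Tt : ∀ {n} k (Y : B (suc n)) (r : Bt (k + n)) →
         .(ft Y ≡ ftⁱ (suc k) (∂ r)) → Bt (k + suc n)
    S  : ∀ {n} k (s : Bt n) (X : B (suc (k + suc n))) →
         .(∂ s ≡ ftⁱ (suc k) X) → B (suc (k + n))
    St : ∀ {n} k (s : Bt n) (r : Bt (k + suc n)) →
         .(∂ s ≡ ftⁱ (suc k) (∂ r)) → Bt (k + n)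
    δ  : ∀ {n} → B (suc n) → Bt (suc n)

-- A unital B0-system: a unital pre-B-system satisfying the B0 axioms.
-- Only the axiom on ft ∘ T is recorded.
record UnitalB0System : Set₁ where
  field
    pre : UnitalPreBSystem
  open UnitalPreBSystem pre public
  field
    ft-T-gt : ∀ {n} k (Y : B (suc n)) (X : B (suc (suc k + n)))
              .(p : ft Y ≡ ftⁱ (suc (suc k)) X) →
              ft (T (suc k) Y X p) ≡ T k Y (ft X) p
    ft-T-eq : ∀ {n} (Y : B (suc n)) (X : B (suc n))
              .(p : ft Y ≡ ftⁱ 1 X) →
              ft (T 0 Y X p) ≡ Y

  ftⁱ-T : ∀ {n} k (Y : B (suc n)) (X : B (suc (k + n)))
          .(p : ft Y ≡ ftⁱ (suc k) X) → ftⁱ (suc k) (T k Y X p) ≡ Y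
  ftⁱ-T zero    Y X p = ft-T-eq Y X p
  ftⁱ-T (suc k) Y X p =
    trans (cong (ftⁱ (suc k)) (ft-T-gt k Y X p)) (ftⁱ-T k Y (ft X) p)

  Tⱼ : ∀ j {n} k (Y : B (j + n)) (X : B (suc (k + n))) →
       ftⁱ j Y ≡ ftⁱ (suc k) X → B (suc (k + (j + n)))
  ftⁱ-Tⱼ : ∀ j {n} k (Y : B (j + n)) (X : B (suc (k + n)))
           (p : ftⁱ j Y ≡ ftⁱ (suc k) X) → ftⁱ (suc k) (Tⱼ j k Y X p) ≡ Y
  Tⱼ zero    k Y X p = X
  Tⱼ (suc j) k Y X p =
    T k Y (Tⱼ j k (ft Y) X p) (sym (ftⁱ-Tⱼ j k (ft Y) X p))
  ftⁱ-Tⱼ zero    k Y X p = sym p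
  ftⁱ-Tⱼ (suc j) k Y X p =
    ftⁱ-T k Y (Tⱼ j k (ft Y) X p) (sym (ftⁱ-Tⱼ j k (ft Y) X p))

module Submission where

-- The only auxiliary fact is that T is a congruence in its second argument:
-- the compatibility proofs are irrelevant, so rewriting the second argument
-- needs no transport of the side condition.

open import Defs
open import Data.Nat using (suc; zero; _+_)
open import Relation.Binary.PropositionalEquality using (_≡_; refl; sym; module ≡-Reasoning)
open ≡-Reasoning

module _ (𝔅 : UnitalB0System) where
  open UnitalB0System 𝔅

  T-cong : ∀ {n} k (Y : B (suc n)) {X X′ : B (suc (k + n))} →
           .{p : ft Y ≡ ftⁱ (suc k) X} .{p′ : ft Y ≡ ftⁱ (suc k) X′} →
           X ≡ X′ → T k Y X p ≡ T k Y X′ p′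
  T-cong k Y refl = refl

lemma2p8 : (𝔅 : UnitalB0System) → let open UnitalB0System 𝔅 in
    ∀ j {n} k (Y : B (j + n)) (X : B (suc (suc k + n)))
    (p : ftⁱ j Y ≡ ftⁱ (suc (suc k)) X) →
    Tⱼ j k Y (ft X) p ≡ ft (Tⱼ j (suc k) Y X p)
lemma2p8 𝔅 zero    k Y X p = refl
lemma2p8 𝔅 (suc j) k Y X p = begin
  T k Y (Tⱼ j k (ft Y) (ft X) p) _         ≡⟨ T-cong 𝔅 k Y (lemma2p8 𝔅 j k (ft Y) X p) ⟩
  T k Y (ft (Tⱼ j (suc k) (ft Y) X p)) _   ≡⟨ sym (ft-T-gt k Y (Tⱼ j (suc k) (ft Y) X p) q) ⟩
  ft (T (suc k) Y (Tⱼ j (suc k) (ft Y) X p) q) ∎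
  where
  open UnitalB0System 𝔅
  q : ft Y ≡ ftⁱ (suc (suc k)) (Tⱼ j (suc k) (ft Y) X p)
  q = sym (ftⁱ-Tⱼ j (suc k) (ft Y) X p)
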